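{- Let $X$ be a super $X$-set parameter, let $G$ be a graph on $n$ vertices, and let $S$ be an $X$-set of $G$. Then $\deg_{\mathfrak{X}(G)}(S)\ge n-|S|$, and $S$ is a minimal $X$-set if and only if $\deg_{\mathfrak{X}(G)}(S)=n-|S|$. Furthermore, $\delta(\mathfrak{X}(G))=n-\overline{X}(G)$.
   Context: All graphs are finite, simple, undirected, with nonempty vertex set. A vertex set property assigns to each graph $G$ a family of subsets of $V(G)$ (the $X$-sets of $G$), invariant under graph isomorphism; it is cohesive if every graph has at least one $X$-set. A super $X$-set parameter is a cohesive vertex set property satisfying: if $S$ is an $X$-set of $G$ and $S\subseteq S'\subseteq V(G)$, then $S'$ is an $X$-set of $G$; $X(G)$ is the minimum cardinality of an $X$-set, and $\overline{X}(G)$ (the upper $X$ number) is the maximum cardinality of a minimal (with respect to inclusion) $X$-set of $G$. The $X$-TAR graph $\mathfrak{X}(G)$ has as vertices the $X$-sets of $G$, with $S_1,S_2$ adjacent iff $|S_1\ominus S_2|=1$. $\delta(H)$ denotes minimum degree. -}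

module Defs where

open import Data.Nat using (ℕ; zero; suc; _≤_; _∸_)
open import Data.Bool using (Bool; true; false; _∧_)
open import Data.Fin using (Fin)
open import Data.Fin.Subset using (Subset; _⊆_; _∪_; _─_; ∣_∣)
open import Data.Fin.Permutation using (Permutation′; _⟨$⟩ʳ_; _⟨$⟩ˡ_)
open import Data.Vec using (Vec; []; _∷_; tabulate; lookup)
open import Data.List using (List; []; _∷_; map; _++_; filterᵇ; length)
open import Data.Product using (Σ; _×_; ∃)
open import Relation.Binary.PropositionalEquality using (_≡_)

-- Finite simple graphs on vertex set Fin n (nonemptiness is imposed
-- where graphs are used, by taking n = suc m).

record Graph (n : ℕ) : Set where
  field
    adj    : Fin n → Fin n → Bool
    sym    : ∀ i j → adj i j ≡ adj j i
    irrefl : ∀ i → adj i i ≡ false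
open Graph public

image : ∀ {n} → Permutation′ n → Subset n → Subset n
image π S = tabulate (λ i → lookup S (π ⟨$⟩ˡ i))

IsIso : ∀ {n} → Graph n → Graph n → Permutation′ n → Set
IsIso G H π = ∀ i j → adj H (π ⟨$⟩ʳ i) (π ⟨$⟩ʳ j) ≡ adj G i j

record SuperXSetParameter : Set₁ where
  field
    isX       : ∀ {m} → Graph (suc m) → Subset (suc m) → Bool
    iso-inv   : ∀ {m} (G H : Graph (suc m)) (π : Permutation′ (suc m)) →
                IsIso G H π → ∀ S → isX H (image π S) ≡ isX G S
    cohesive  : ∀ {m} (G : Graph (suc m)) → ∃ λ S → isX G S ≡ true
    superset  : ∀ {m} (G : Graph (suc m)) (S S′ : Subset (suc m)) →
                isX G S ≡ true → S ⊆ S′ → isX G S′ ≡ true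
open SuperXSetParameter public

-- All subsets of Fin n (the candidate vertices of the TAR graph)

allSubsets : ∀ n → List (Subset n)
allSubsets zero    = [] ∷ []
allSubsets (suc n) = map (true ∷_) (allSubsets n) ++ map (false ∷_) (allSubsets n)

_⊖_ : ∀ {n} → Subset n → Subset n → Subset n
S ⊖ T = (S ─ T) ∪ (T ─ S)

isOne : ℕ → Bool
isOne (suc zero) = true
isOne _          = false

module _ (P : SuperXSetParameter) {m : ℕ} (G : Graph (suc m)) where

  XSet : Subset (suc m) → Set
  XSet S = isX P G S ≡ true

  TARadj : Subset (suc m) → Subset (suc m) → Bool
  TARadj S T = isX P G T ∧ isOne ∣ S ⊖ T ∣

  tarDegree : Subset (suc m) → ℕ
  tarDegree S = length (filterᵇ (TARadj S) (allSubsets (suc m)))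

  MinimalXSet : Subset (suc m) → Set
  MinimalXSet S = XSet S × (∀ T → T ⊆ S → XSet T → T ≡ S)

  IsUpperX : ℕ → Set
  IsUpperX k = (∃ λ S → MinimalXSet S × ∣ S ∣ ≡ k)
             × (∀ S → MinimalXSet S → ∣ S ∣ ≤ k)

  IsMinDegreeTAR : ℕ → Set
  IsMinDegreeTAR d = (∃ λ S → XSet S × tarDegree S ≡ d)
                   × (∀ S → XSet S → d ≤ tarDegree S)

-- Flipping one coordinate of an X-set S gives an X-set whenever a vertex
-- outside S is added (supersets of X-sets are X-sets), and whenever a
-- removable vertex of S is deleted.  So deg S = (n − |S|) + r(S), where r(S)
-- counts the removable vertices, and r(S) = 0 exactly when S is minimal.
-- Every X-set S contains a minimal X-set T, and each vertex of S − T is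
-- removable, so |S| ≤ |T| + r(S) ≤ X̄(G) + r(S); hence deg S ≥ n − X̄(G),
-- with equality at a minimal X-set of size X̄(G).
module Submission where

open import Defs hiding (sym)
open import Data.Bool using (Bool; true; false; _∧_; not)
open import Data.Bool.Properties using (∧-identityʳ; ∧-zeroʳ)
open import Data.Fin.Subset using (Subset; _⊆_; ∣_∣)
open import Data.Fin.Subset.Properties using (drop-∷-⊆; out⊆; s⊆s; ⊆-refl; ∣p∣≤n)
open import Data.List using (List; []; _∷_; _++_; map; filterᵇ; length)
open import Data.List.Properties using (length-++; filter-++)
open import Data.Nat using (ℕ; zero; suc; _+_; _∸_; _≤_; z≤n; s≤s)
open import Data.Nat.Properties
open import Algebra.Properties.CommutativeSemigroup +-commutativeSemigroup using (x∙yz≈y∙xz)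
open import Data.Product using (_×_; _,_; ∃-syntax)
open import Data.Vec using ([]; _∷_; here)
open import Function using (_∘_)
open import Function.Bundles using (_⇔_; mk⇔)
open import Relation.Binary.PropositionalEquality
  using (_≡_; refl; sym; trans; cong; cong₂; subst; module ≡-Reasoning)
open import Relation.Nullary using (contradiction)

toℕ : Bool → ℕ
toℕ true  = 1
toℕ false = 0

toℕ≡0⇒false : ∀ {b} → toℕ b ≡ 0 → b ≡ false
toℕ≡0⇒false {false} _ = refl

m∸o≤m∸n+p : ∀ m n o p → n ≤ o + p → m ∸ o ≤ (m ∸ n) + p
m∸o≤m∸n+p m       zero    o       p _         = ≤-trans (m∸n≤m m o) (m≤m+n m p)
m∸o≤m∸n+p m       (suc n) zero    p n≤p       = ≤-trans (m≤n+m∸n m (suc n))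
  (≤-trans (+-monoˡ-≤ (m ∸ suc n) n≤p) (≤-reflexive (+-comm p (m ∸ suc n))))
m∸o≤m∸n+p zero    (suc n) (suc o) p _         = z≤n
m∸o≤m∸n+p (suc m) (suc n) (suc o) p (s≤s n≤o) = m∸o≤m∸n+p m n o p n≤o

countSubsets : ∀ n → (Subset n → Bool) → ℕ
countSubsets zero    p = toℕ (p [])
countSubsets (suc n) p = countSubsets n (p ∘ (true ∷_)) + countSubsets n (p ∘ (false ∷_))

length-filterᵇ-map : ∀ {A B : Set} (p : B → Bool) (g : A → B) (xs : List A) →
  length (filterᵇ p (map g xs)) ≡ length (filterᵇ (p ∘ g) xs)
length-filterᵇ-map p g []       = refl
length-filterᵇ-map p g (x ∷ xs) with p (g x)
... | true  = cong suc (length-filterᵇ-map p g xs)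
... | false = length-filterᵇ-map p g xs

length-filterᵇ-allSubsets : ∀ n (p : Subset n → Bool) →
  length (filterᵇ p (allSubsets n)) ≡ countSubsets n p
length-filterᵇ-allSubsets zero p with p []
... | true  = refl
... | false = refl
length-filterᵇ-allSubsets (suc n) p = begin
  length (filterᵇ p (ins ++ outs))
    ≡⟨ cong length (filter-++ _ ins outs) ⟩
  length (filterᵇ p ins ++ filterᵇ p outs)
    ≡⟨ length-++ (filterᵇ p ins) ⟩
  length (filterᵇ p ins) + length (filterᵇ p outs)
    ≡⟨ cong₂ _+_ (length-filterᵇ-map p (true ∷_) (allSubsets n))
                 (length-filterᵇ-map p (false ∷_) (allSubsets n)) ⟩
  length (filterᵇ (p ∘ (true ∷_)) (allSubsets n)) + length (filterᵇ (p ∘ (false ∷_)) (allSubsets n))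
    ≡⟨ cong₂ _+_ (length-filterᵇ-allSubsets n _) (length-filterᵇ-allSubsets n _) ⟩
  countSubsets (suc n) p ∎
  where
  open ≡-Reasoning
  ins  = map (true ∷_) (allSubsets n)
  outs = map (false ∷_) (allSubsets n)

countSubsets-false : ∀ n (p : Subset n → Bool) → (∀ T → p T ≡ false) → countSubsets n p ≡ 0
countSubsets-false zero    p p≡false rewrite p≡false [] = refl
countSubsets-false (suc n) p p≡false = cong₂ _+_
  (countSubsets-false n _ (p≡false ∘ (true ∷_)))
  (countSubsets-false n _ (p≡false ∘ (false ∷_)))

flipCount : ∀ {n} → (Subset n → Bool) → Subset n → ℕ
flipCount f []      = 0
flipCount f (b ∷ S) = toℕ (f (not b ∷ S)) + flipCount (f ∘ (b ∷_)) S

-- Distance zero is expressed as isOne (suc d), the shape in which it arises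
-- from distance one after a differing coordinate.
countSubsets-distance0 : ∀ n (f : Subset n → Bool) (S : Subset n) →
  countSubsets n (λ T → f T ∧ isOne (suc ∣ S ⊖ T ∣)) ≡ toℕ (f S)
countSubsets-distance0 zero    f []          = cong toℕ (∧-identityʳ (f []))
countSubsets-distance0 (suc n) f (true ∷ S)  = trans
  (cong₂ _+_ (countSubsets-distance0 n (f ∘ (true ∷_)) S)
             (countSubsets-false n _ (λ T → ∧-zeroʳ (f (false ∷ T)))))
  (+-identityʳ _)
countSubsets-distance0 (suc n) f (false ∷ S) = cong₂ _+_
  (countSubsets-false n _ (λ T → ∧-zeroʳ (f (true ∷ T))))
  (countSubsets-distance0 n (f ∘ (false ∷_)) S)

countSubsets-distance1 : ∀ n (f : Subset n → Bool) (S : Subset n) →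
  countSubsets n (λ T → f T ∧ isOne ∣ S ⊖ T ∣) ≡ flipCount f S
countSubsets-distance1 zero    f []          = cong toℕ (∧-zeroʳ (f []))
countSubsets-distance1 (suc n) f (true ∷ S)  = trans
  (cong₂ _+_ (countSubsets-distance1 n (f ∘ (true ∷_)) S)
             (countSubsets-distance0 n (f ∘ (false ∷_)) S))
  (+-comm (flipCount (f ∘ (true ∷_)) S) (toℕ (f (false ∷ S))))
countSubsets-distance1 (suc n) f (false ∷ S) = cong₂ _+_
  (countSubsets-distance0 n (f ∘ (true ∷_)) S)
  (countSubsets-distance1 n (f ∘ (false ∷_)) S)

Upward : ∀ {n} → (Subset n → Bool) → Set
Upward f = ∀ {S T} → f S ≡ true → S ⊆ T → f T ≡ true

upward-∷ : ∀ {n} {f : Subset (suc n) → Bool} b → Upward f → Upward (f ∘ (b ∷_))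
upward-∷ b up fS S⊆T = up fS (s⊆s S⊆T)

removableCount : ∀ {n} → (Subset n → Bool) → Subset n → ℕ
removableCount f []          = 0
removableCount f (true ∷ S)  = toℕ (f (false ∷ S)) + removableCount (f ∘ (true ∷_)) S
removableCount f (false ∷ S) = removableCount (f ∘ (false ∷_)) S

flipCount-upward : ∀ {n} (f : Subset n → Bool) {S} → Upward f → f S ≡ true →
  flipCount f S ≡ (n ∸ ∣ S ∣) + removableCount f S
flipCount-upward f {[]} up fS = refl
flipCount-upward {suc n} f {true ∷ S} up fS = trans
  (cong (toℕ (f (false ∷ S)) +_) (flipCount-upward _ (upward-∷ true up) fS))
  (x∙yz≈y∙xz (toℕ (f (false ∷ S))) (n ∸ ∣ S ∣) (removableCount (f ∘ (true ∷_)) S))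
flipCount-upward {suc n} f {false ∷ S} up fS
  rewrite up fS (out⊆ {s = true} ⊆-refl)
        | +-∸-assoc 1 (∣p∣≤n S)
  = cong suc (flipCount-upward _ (upward-∷ false up) fS)

Irreducible : ∀ {n} → (Subset n → Bool) → Subset n → Set
Irreducible f S = ∀ T → T ⊆ S → f T ≡ true → T ≡ S

Minimal : ∀ {n} → (Subset n → Bool) → Subset n → Set
Minimal f S = f S ≡ true × Irreducible f S

irreducible-∷⁻ : ∀ {n} {f : Subset (suc n) → Bool} {S} b →
  Irreducible f (b ∷ S) → Irreducible (f ∘ (b ∷_)) S
irreducible-∷⁻ b irr T T⊆S fT with irr (b ∷ T) (s⊆s T⊆S) fT
... | refl = refl

irreducible-false∷ : ∀ {n} {f : Subset (suc n) → Bool} {S} →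
  Irreducible (f ∘ (false ∷_)) S → Irreducible f (false ∷ S)
irreducible-false∷ irr (true ∷ T)  T⊆S fT = contradiction (T⊆S here) λ ()
irreducible-false∷ irr (false ∷ T) T⊆S fT = cong (false ∷_) (irr T (drop-∷-⊆ T⊆S) fT)

irreducible-true∷ : ∀ {n} {f : Subset (suc n) → Bool} {S} → Upward f → f (false ∷ S) ≡ false →
  Irreducible (f ∘ (true ∷_)) S → Irreducible f (true ∷ S)
irreducible-true∷ up f[false∷S] irr (true ∷ T)  T⊆S fT = cong (true ∷_) (irr T (drop-∷-⊆ T⊆S) fT)
irreducible-true∷ up f[false∷S] irr (false ∷ T) T⊆S fT =
  contradiction (trans (sym (up fT (s⊆s (drop-∷-⊆ T⊆S)))) f[false∷S]) λ ()

irreducible⇒removableCount≡0 : ∀ {n} (f : Subset n → Bool) {S} →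
  Irreducible f S → removableCount f S ≡ 0
irreducible⇒removableCount≡0 f {[]}        irr = refl
irreducible⇒removableCount≡0 f {true ∷ S}  irr with f (false ∷ S) in f[false∷S]
... | true  = contradiction (irr (false ∷ S) (out⊆ ⊆-refl) f[false∷S]) λ ()
... | false = irreducible⇒removableCount≡0 _ (irreducible-∷⁻ true irr)
irreducible⇒removableCount≡0 f {false ∷ S} irr =
  irreducible⇒removableCount≡0 _ (irreducible-∷⁻ false irr)

removableCount≡0⇒irreducible : ∀ {n} (f : Subset n → Bool) {S} → Upward f →
  removableCount f S ≡ 0 → Irreducible f S
removableCount≡0⇒irreducible f {[]}        up r≡0 [] _ _ = refl
removableCount≡0⇒irreducible f {true ∷ S}  up r≡0 = irreducible-true∷ up
  (toℕ≡0⇒false (m+n≡0⇒m≡0 _ r≡0))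
  (removableCount≡0⇒irreducible _ (upward-∷ true up) (m+n≡0⇒n≡0 _ r≡0))
removableCount≡0⇒irreducible f {false ∷ S} up r≡0 = irreducible-false∷
  (removableCount≡0⇒irreducible _ (upward-∷ false up) r≡0)

minimal-⊆ : ∀ {n} (f : Subset n → Bool) {S} → Upward f → f S ≡ true →
  ∃[ T ] T ⊆ S × Minimal f T
minimal-⊆ f {[]} up fS = [] , ⊆-refl , fS , λ { [] _ _ → refl }
minimal-⊆ f {false ∷ S} up fS with minimal-⊆ _ (upward-∷ false up) fS
... | T , T⊆S , fT , irr = false ∷ T , s⊆s T⊆S , fT , irreducible-false∷ irr
minimal-⊆ f {true ∷ S} up fS with f (false ∷ S) in f[false∷S]
... | true with minimal-⊆ _ (upward-∷ false up) f[false∷S]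
...   | T , T⊆S , fT , irr = false ∷ T , out⊆ T⊆S , fT , irreducible-false∷ irr
minimal-⊆ f {true ∷ S} up fS | false with minimal-⊆ _ (upward-∷ true up) fS
... | T , T⊆S , fT , irr = true ∷ T , s⊆s T⊆S , fT , irreducible-true∷ up f[false∷T] irr
  where
  f[false∷T] : f (false ∷ T) ≡ false
  f[false∷T] with f (false ∷ T) in e
  ... | true  = contradiction (trans (sym (up e (s⊆s T⊆S))) f[false∷S]) λ ()
  ... | false = refl

-- Every element of S − T is removable from S, since S minus it still contains T.
∣∣≤∣∣+removableCount : ∀ {n} (f : Subset n → Bool) {S T} → Upward f →
  T ⊆ S → f T ≡ true → ∣ S ∣ ≤ ∣ T ∣ + removableCount f S
∣∣≤∣∣+removableCount f {[]}        {[]}        up T⊆S fT = z≤n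
∣∣≤∣∣+removableCount f {true ∷ S}  {true ∷ T}  up T⊆S fT = s≤s (≤-trans
  (∣∣≤∣∣+removableCount _ (upward-∷ true up) (drop-∷-⊆ T⊆S) fT)
  (+-monoʳ-≤ ∣ T ∣ (m≤n+m _ (toℕ (f (false ∷ S))))))
∣∣≤∣∣+removableCount f {true ∷ S}  {false ∷ T} up T⊆S fT
  rewrite up fT (s⊆s {s = false} (drop-∷-⊆ T⊆S))
        | +-suc ∣ T ∣ (removableCount (f ∘ (true ∷_)) S)
  = s≤s (∣∣≤∣∣+removableCount _ (upward-∷ true up) (drop-∷-⊆ T⊆S) (up fT (out⊆ ⊆-refl)))
∣∣≤∣∣+removableCount f {false ∷ S} {true ∷ T}  up T⊆S fT = contradiction (T⊆S here) λ ()
∣∣≤∣∣+removableCount f {false ∷ S} {false ∷ T} up T⊆S fT =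
  ∣∣≤∣∣+removableCount _ (upward-∷ false up) (drop-∷-⊆ T⊆S) fT

module _ (P : SuperXSetParameter) {m : ℕ} (G : Graph (suc m)) where

  private
    n = suc m

  upward-isX : Upward (isX P G)
  upward-isX = superset P G _ _

  tarDegree-XSet : ∀ {S} → XSet P G S → tarDegree P G S ≡ (n ∸ ∣ S ∣) + removableCount (isX P G) S
  tarDegree-XSet {S} xS = begin
    tarDegree P G S                       ≡⟨ length-filterᵇ-allSubsets n (TARadj P G S) ⟩
    countSubsets n (TARadj P G S)         ≡⟨ countSubsets-distance1 n (isX P G) S ⟩
    flipCount (isX P G) S                 ≡⟨ flipCount-upward (isX P G) upward-isX xS ⟩
    (n ∸ ∣ S ∣) + removableCount (isX P G) S ∎
    where open ≡-Reasoning

  n∸∣∣≤tarDegree : ∀ {S} → XSet P G S → n ∸ ∣ S ∣ ≤ tarDegree P G S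
  n∸∣∣≤tarDegree xS = subst (_ ≤_) (sym (tarDegree-XSet xS)) (m≤m+n _ _)

  minimal⇒tarDegree≡n∸∣∣ : ∀ {S} → MinimalXSet P G S → tarDegree P G S ≡ n ∸ ∣ S ∣
  minimal⇒tarDegree≡n∸∣∣ (xS , irr) = trans (tarDegree-XSet xS)
    (trans (cong (_ +_) (irreducible⇒removableCount≡0 (isX P G) irr)) (+-identityʳ _))

  tarDegree≡n∸∣∣⇒minimal : ∀ {S} → XSet P G S → tarDegree P G S ≡ n ∸ ∣ S ∣ → MinimalXSet P G S
  tarDegree≡n∸∣∣⇒minimal {S} xS deg≡ = xS , removableCount≡0⇒irreducible (isX P G) upward-isX
    (+-cancelˡ-≡ (n ∸ ∣ S ∣) _ _ (trans (sym (tarDegree-XSet xS)) (trans deg≡ (sym (+-identityʳ _)))))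

  minimal-tarDegree≤ : ∀ {S} → XSet P G S → ∃[ T ] MinimalXSet P G T × n ∸ ∣ T ∣ ≤ tarDegree P G S
  minimal-tarDegree≤ {S} xS with minimal-⊆ (isX P G) upward-isX xS
  ... | T , T⊆S , minT@(xT , _) = T , minT , subst (n ∸ ∣ T ∣ ≤_) (sym (tarDegree-XSet xS))
    (m∸o≤m∸n+p n ∣ S ∣ ∣ T ∣ _ (∣∣≤∣∣+removableCount (isX P G) upward-isX T⊆S xT))

proposition2p17 : (P : SuperXSetParameter) (m : ℕ) (G : Graph (suc m)) →
    ((S : Subset (suc m)) → XSet P G S →
      (suc m ∸ ∣ S ∣ ≤ tarDegree P G S)
      × (MinimalXSet P G S ⇔ (tarDegree P G S ≡ suc m ∸ ∣ S ∣)))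
    × ((k : ℕ) → IsUpperX P G k → IsMinDegreeTAR P G (suc m ∸ k))
proposition2p17 P m G =
  (λ S xS → n∸∣∣≤tarDegree P G xS
           , mk⇔ (minimal⇒tarDegree≡n∸∣∣ P G) (tarDegree≡n∸∣∣⇒minimal P G xS))
  , minimumDegree
  where
  minimumDegree : (k : ℕ) → IsUpperX P G k → IsMinDegreeTAR P G (suc m ∸ k)
  minimumDegree k ((S , minS@(xS , _) , ∣S∣≡k) , ∣minimal∣≤k) =
    (S , xS , trans (minimal⇒tarDegree≡n∸∣∣ P G minS) (cong (suc m ∸_) ∣S∣≡k)) ,
    λ S′ xS′ → let T , minT , bound = minimal-tarDegree≤ P G xS′
               in ≤-trans (∸-monoʳ-≤ (suc m) (∣minimal∣≤k T minT)) bound
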